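{- The set of terms of the sequence $\mathcal{Z}_{(2,1)}(1,3)$ is $$\{3,15\}\cup\big((4\mathbb{Z}_{\geqslant 0}+1)\setminus\{9\}\big)=\{1,3,5,13,15,17,21,25,\dots\}.$$
   Context: For positive integers $a<b$, the $(2,1)$-sequence $\mathcal{Z}_{(2,1)}(a,b)=(a_m)_{m\geqslant1}$ is defined greedily by $a_1=a$, $a_2=b$, and, for $m\geqslant 2$, $a_{m+1}$ is the smallest integer larger than $a_m$ for which there is exactly one ordered pair $(x,y)$ of distinct earlier terms $x,y\in\{a_1,\dots,a_m\}$, $x\neq y$, with $2x+y=a_{m+1}$. -}

module Defs where

open import Data.Nat using (ℕ; zero; suc; _+_; _*_; _≡ᵇ_)
open import Data.Nat.DivMod using (_%_)
open import Data.Bool using (Bool; true; false; if_then_else_; _∧_; not)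
open import Data.List using (List; []; _∷_; map; concatMap; filterᵇ; length)
open import Data.List.Membership.Propositional using (_∈_)
open import Data.Maybe using (Maybe; just; nothing)
open import Data.Product using (_×_; _,_; ∃-syntax)
open import Data.Sum using (_⊎_)
open import Relation.Binary.PropositionalEquality using (_≡_; _≢_)

-- Number of ordered pairs (x , y) of distinct terms x ≠ y from the list
-- of earlier terms (all terms are distinct) with 2x + y = n.
reps : List ℕ → ℕ → ℕ
reps xs n =
  length (filterᵇ (λ p → good p)
                  (concatMap (λ x → map (λ y → (x , y)) xs) xs))
  where
  good : ℕ × ℕ → Bool
  good (x , y) = not (x ≡ᵇ y) ∧ ((2 * x + y) ≡ᵇ n)

search : ℕ → ℕ → List ℕ → Maybe ℕ
search zero    c xs = nothing
search (suc f) c xs = if reps xs c ≡ᵇ 1 then just c else search f (suc c) xs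

-- Every value
-- 2x+y with earlier terms x,y is ≤ 3·(last term), so searching the window
-- (last, 3·last] finds the least admissible value whenever one exists.
next : List ℕ → Maybe ℕ
next []          = nothing
next (last ∷ xs) = search (2 * last) (suc last) (last ∷ xs)

Z : ℕ → ℕ → ℕ → List ℕ
Z a b zero    = b ∷ a ∷ []
Z a b (suc k) with next (Z a b k)
... | just c  = c ∷ Z a b k
... | nothing = Z a b k

IsTerm : ℕ → ℕ → ℕ → Set
IsTerm a b n = ∃[ k ] n ∈ Z a b k

TargetSet : ℕ → Set
TargetSet n = n ≡ 3 ⊎ n ≡ 15 ⊎ (n % 4 ≡ 1 × n ≢ 9)

-- After its first six terms 1, 3, 5, 13, 15, 17 the sequence is the progression
-- 21, 25, 29, …; the small steps are checked by evaluation.  Let t = 21 + 4j ≥ 49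
-- be the last term.  All terms are odd, so the even candidates t + 1 and t + 3
-- have no representation, while t + 2 = 2·1 + t = 2·5 + (t − 8) has two.  The
-- candidate n = t + 4 is 1 mod 4, and so are all terms except 3 and 15, whereas
-- 2x + y ≡ 2 + y (mod 4) for odd x; hence y ∈ {3, 15}, and x ∈ {(n − 3)/2,
-- (n − 15)/2}.  These two values differ by 6, so exactly one of them is 1 mod 4
-- and then lies in the progression: n has exactly one representation.
module Submission where

open import Defs
open import Data.Nat using (ℕ; zero; suc; _+_; _*_; _≤_; _<_; _≡ᵇ_; _≤ᵇ_; z≤n; s≤s; z<s; NonZero)
open import Function.Bundles using (_⇔_; mk⇔)

open import Data.Bool using (Bool; true; false; T; not; _∧_)
open import Data.Bool.Properties using (∧-zeroʳ)
open import Data.Empty using (⊥-elim)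
open import Data.List using (List; []; _∷_; _++_; map; concatMap; filterᵇ; length; applyDownFrom)
open import Data.List.Properties using (map-++; map-∘; map-cong; map-cong-local)
open import Data.List.Membership.Propositional using (_∈_)
open import Data.List.Membership.Propositional.Properties using (∈-++⁺ˡ; ∈-++⁺ʳ; ∈-applyDownFrom⁺)
open import Data.List.Relation.Unary.All as All using (All; []; _∷_)
open import Data.List.Relation.Unary.All.Properties using (++⁺; applyDownFrom⁺₁; applyDownFrom⁺₂)
open import Data.List.Relation.Unary.Any using (here; there)
open import Data.Maybe using (just; nothing)
open import Data.Nat.DivMod using (_%_; _/_; m≡m%n+[m/n]*n; [m+kn]%n≡m%n; m<n⇒m%n≡m)
open import Data.Nat.ListAction using (sum)
open import Data.Nat.ListAction.Properties using (sum-++)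
open import Data.Nat.Properties
open import Data.Nat.Tactic.RingSolver using (solve-∀)
open import Algebra.Properties.CommutativeSemigroup +-commutativeSemigroup using (interchange)
open import Data.Product using (_×_; _,_; ∃-syntax)
open import Data.Sum using (_⊎_; inj₁; inj₂)
open import Function.Base using (_∘_; case_of_)
open import Relation.Nullary using (yes; no)
open import Relation.Binary.PropositionalEquality

private
  variable
    A B : Set
    a b c f k m n p r s x y : ℕ
    xs : List ℕ

infix 4 _≡_mod_

_≡_mod_ : ℕ → ℕ → ℕ → Set
x ≡ r mod m = ∃[ q ] x ≡ r + q * m

mod-unique : .{{_ : NonZero m}} → r < m → s < m → x ≡ r mod m → x ≡ s mod m → r ≡ s
mod-unique {m} {r} {s} r<m s<m (a , refl) (b , e) = begin
  r                ≡⟨ m<n⇒m%n≡m r<m ⟨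
  r % m            ≡⟨ [m+kn]%n≡m%n r a m ⟨
  (r + a * m) % m  ≡⟨ cong (_% m) e ⟩
  (s + b * m) % m  ≡⟨ [m+kn]%n≡m%n s b m ⟩
  s % m            ≡⟨ m<n⇒m%n≡m s<m ⟩
  s                ∎
  where open ≡-Reasoning

%≡⇒mod : .{{_ : NonZero m}} → n % m ≡ r → n ≡ r mod m
%≡⇒mod {m} {n} refl = n / m , m≡m%n+[m/n]*n n m

mod⇒%≡ : .{{_ : NonZero m}} → r < m → n ≡ r mod m → n % m ≡ r
mod⇒%≡ {m} {r} r<m (q , refl) = trans ([m+kn]%n≡m%n r q m) (m<n⇒m%n≡m r<m)

mod2-cases : ∀ n → n ≡ 0 mod 2 ⊎ n ≡ 1 mod 2
mod2-cases zero = inj₁ (0 , refl)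
mod2-cases (suc n) with mod2-cases n
... | inj₁ (q , e) = inj₂ (q , cong suc e)
... | inj₂ (q , e) = inj₁ (suc q , cong suc e)

⟦_⟧ : Bool → ℕ
⟦ true ⟧  = 1
⟦ false ⟧ = 0

length-filterᵇ : (P : A → Bool) (zs : List A) → length (filterᵇ P zs) ≡ sum (map (λ z → ⟦ P z ⟧) zs)
length-filterᵇ P [] = refl
length-filterᵇ P (z ∷ zs) with P z
... | true  = cong suc (length-filterᵇ P zs)
... | false = length-filterᵇ P zs

sum-map-++ : (g : A → ℕ) (us vs : List A) → sum (map g (us ++ vs)) ≡ sum (map g us) + sum (map g vs)
sum-map-++ g us vs = trans (cong sum (map-++ g us vs)) (sum-++ (map g us) (map g vs))

sum-map-concatMap : (g : B → ℕ) (h : A → List B) (us : List A) →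
                    sum (map g (concatMap h us)) ≡ sum (map (λ u → sum (map g (h u))) us)
sum-map-concatMap g h [] = refl
sum-map-concatMap g h (u ∷ us) =
  trans (sum-map-++ g (h u) (concatMap h us)) (cong (sum (map g (h u)) +_) (sum-map-concatMap g h us))

sum-map-cong : {g h : A → ℕ} {us : List A} → All (λ u → g u ≡ h u) us → sum (map g us) ≡ sum (map h us)
sum-map-cong eqs = cong sum (map-cong-local eqs)

sum-map-≡0 : {g : A → ℕ} {us : List A} → All (λ u → g u ≡ 0) us → sum (map g us) ≡ 0
sum-map-≡0 [] = refl
sum-map-≡0 {g = g} {_ ∷ us} (gu≡0 ∷ zeros) = trans (cong (_+ sum (map g us)) gu≡0) (sum-map-≡0 zeros)

sum-map-+ : (g h : A → ℕ) (us : List A) → sum (map (λ u → g u + h u) us) ≡ sum (map g us) + sum (map h us)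
sum-map-+ g h [] = refl
sum-map-+ g h (u ∷ us) = trans (cong (g u + h u +_) (sum-map-+ g h us)) (interchange (g u) (h u) _ _)

≤sum-map : (g : ℕ → ℕ) → x ∈ xs → g x ≤ sum (map g xs)
≤sum-map g (here refl) = m≤m+n _ _
≤sum-map g (there x∈xs) = ≤-trans (≤sum-map g x∈xs) (m≤n+m _ _)

+≤sum-map : (g : ℕ → ℕ) → x ∈ xs → y ∈ xs → x ≢ y → g x + g y ≤ sum (map g xs)
+≤sum-map g (here refl) (here refl)   x≢y = ⊥-elim (x≢y refl)
+≤sum-map g (here refl) (there y∈xs)  _   = +-monoʳ-≤ _ (≤sum-map g y∈xs)
+≤sum-map {x} {_ ∷ xs} {y} g (there x∈xs) (here refl) _ =
  subst (_≤ g y + sum (map g xs)) (+-comm (g y) (g x)) (+-monoʳ-≤ (g y) (≤sum-map g x∈xs))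
+≤sum-map g (there x∈xs) (there y∈xs) x≢y = ≤-trans (+≤sum-map g x∈xs y∈xs x≢y) (m≤n+m _ _)

sum-map-applyDownFrom≡1 : (g h : ℕ → ℕ) → p < k →
                          g (h p) ≡ 1 → (∀ i → i < k → i ≢ p → g (h i) ≡ 0) → sum (map g (applyDownFrom h k)) ≡ 1
sum-map-applyDownFrom≡1 {p} {suc k} g h p<k hit miss with p ≟ k
... | yes refl = cong₂ _+_ hit (sum-map-≡0 (applyDownFrom⁺₁ h k λ i<p → miss _ (m≤n⇒m≤1+n i<p) (<⇒≢ i<p)))
... | no p≢k   = cong₂ _+_ (miss k ≤-refl (≢-sym p≢k)) (sum-map-applyDownFrom≡1 g h p<k′ hit miss′)
  where
  p<k′ : p < k
  p<k′ = ≤∧≢⇒< (≤-pred p<k) p≢k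
  miss′ : ∀ i → i < k → i ≢ p → g (h i) ≡ 0
  miss′ i i<k = miss i (m≤n⇒m≤1+n i<k)

-- The indicator of the filter in reps; opaque so that rep n x y determines n, x and y for unification.
opaque
  rep : ℕ → ℕ → ℕ → ℕ
  rep n x y = ⟦ not (x ≡ᵇ y) ∧ (2 * x + y ≡ᵇ n) ⟧

  reps≡sum-rep : ∀ xs n → reps xs n ≡ sum (map (λ x → sum (map (rep n x) xs)) xs)
  reps≡sum-rep xs n = begin
    reps xs n
      ≡⟨ length-filterᵇ _ (concatMap pairs xs) ⟩
    sum (map (λ (x , y) → rep n x y) (concatMap pairs xs))
      ≡⟨ sum-map-concatMap (λ (x , y) → rep n x y) pairs xs ⟩
    sum (map (λ x → sum (map (λ (x , y) → rep n x y) (pairs x))) xs)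
      ≡⟨ cong sum (map-cong (λ x → cong sum (map-∘ {g = λ (x , y) → rep n x y} {f = x ,_} xs)) xs) ⟨
    sum (map (λ x → sum (map (rep n x) xs)) xs) ∎
    where
    open ≡-Reasoning
    pairs : ℕ → List (ℕ × ℕ)
    pairs x = map (x ,_) xs

  rep≡0 : 2 * x + y ≢ n → rep n x y ≡ 0
  rep≡0 {x} {y} {n} 2x+y≢n with 2 * x + y ≡ᵇ n in eq
  ... | false = cong ⟦_⟧ (∧-zeroʳ (not (x ≡ᵇ y)))
  ... | true  = ⊥-elim (2x+y≢n (≡ᵇ⇒≡ _ _ (subst T (sym eq) _)))

  rep≡1 : x ≢ y → 2 * x + y ≡ n → rep n x y ≡ 1
  rep≡1 {x} {y} {n} x≢y 2x+y≡n with x ≡ᵇ y in eq₁ | 2 * x + y ≡ᵇ n in eq₂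
  ... | false | true  = refl
  ... | true  | _     = ⊥-elim (x≢y (≡ᵇ⇒≡ _ _ (subst T (sym eq₁) _)))
  ... | false | false = ⊥-elim (subst T eq₂ (≡⇒≡ᵇ _ _ 2x+y≡n))

rep≡0-mod : .{{_ : NonZero m}} → r < m → s < m → r ≢ s →
            2 * x + y ≡ r mod m → n ≡ s mod m → rep n x y ≡ 0
rep≡0-mod r<m s<m r≢s 2x+y≡r n≡s =
  rep≡0 λ 2x+y≡n → r≢s (mod-unique r<m s<m 2x+y≡r (subst (_≡ _ mod _) (sym 2x+y≡n) n≡s))

rep≡0-< : 2 * x + y < n → rep n x y ≡ 0
rep≡0-< 2x+y<n = rep≡0 (<⇒≢ 2x+y<n)

search-skip : reps xs c ≢ 1 → search (suc f) c xs ≡ search f (suc c) xs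
search-skip {xs} {c} reps≢1 with reps xs c ≡ᵇ 1 in eq
... | false = refl
... | true  = ⊥-elim (reps≢1 (≡ᵇ⇒≡ _ _ (subst T (sym eq) _)))

search-hit : reps xs c ≡ 1 → search (suc f) c xs ≡ just c
search-hit reps≡1 rewrite reps≡1 = refl

search-first : ∀ f c d → d < f → (∀ i → i < d → reps xs (i + c) ≢ 1) → reps xs (d + c) ≡ 1 →
               search f c xs ≡ just (d + c)
search-first {xs} (suc f) c zero _ _ hit = search-hit {xs} {c} {f} hit
search-first {xs} (suc f) c (suc d) (s≤s d<f) miss hit = begin
  search (suc f) c xs  ≡⟨ search-skip {xs} {c} {f} (miss 0 z<s) ⟩
  search f (suc c) xs  ≡⟨ search-first f (suc c) d d<f miss′ hit′ ⟩
  just (d + suc c)     ≡⟨ cong just (+-suc d c) ⟩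
  just (suc d + c)     ∎
  where
  open ≡-Reasoning
  miss′ : ∀ i → i < d → reps xs (i + suc c) ≢ 1
  miss′ i i<d = subst (λ v → reps xs v ≢ 1) (sym (+-suc i c)) (miss (suc i) (s≤s i<d))
  hit′ : reps xs (d + suc c) ≡ 1
  hit′ = subst (λ v → reps xs v ≡ 1) (sym (+-suc d c)) hit

Z-step : next (Z a b k) ≡ just c → Z a b (suc k) ≡ c ∷ Z a b k
Z-step {a} {b} {k} eq with next (Z a b k) | eq
... | just _ | refl = refl

∈-Z-suc : x ∈ Z a b k → x ∈ Z a b (suc k)
∈-Z-suc {a = a} {b} {k} x∈Z with next (Z a b k)
... | just _  = there x∈Z
... | nothing = x∈Z

∈-Z-+ : ∀ d → x ∈ Z a b k → x ∈ Z a b (d + k)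
∈-Z-+ zero    x∈Z = x∈Z
∈-Z-+ {a = a} {b} {k} (suc d) x∈Z = ∈-Z-suc {a = a} {b} {d + k} (∈-Z-+ d x∈Z)

initial : List ℕ
initial = 17 ∷ 15 ∷ 13 ∷ 5 ∷ 3 ∷ 1 ∷ []

progression : ℕ → List ℕ
progression = applyDownFrom (λ i → 21 + 4 * i)

terms : ℕ → List ℕ
terms k = progression k ++ initial

progression-mod4 : ∀ i → 21 + 4 * i ≡ 1 mod 4
progression-mod4 i = 5 + i , lemma i
  where
  lemma : ∀ i → 21 + 4 * i ≡ 1 + (5 + i) * 4
  lemma = solve-∀

All-TargetSet-terms : ∀ k → All TargetSet (terms k)
All-TargetSet-terms k = ++⁺ (applyDownFrom⁺₂ _ k in-progression) in-initial
  where
  in-progression : ∀ i → TargetSet (21 + 4 * i)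
  in-progression i = inj₂ (inj₂ (mod⇒%≡ (≤ᵇ⇒≤ _ _ _) (progression-mod4 i) , λ ()))
  in-initial : All TargetSet initial
  in-initial = inj₂ (inj₂ (refl , λ ())) ∷ inj₂ (inj₁ refl) ∷ inj₂ (inj₂ (refl , λ ()))
             ∷ inj₂ (inj₂ (refl , λ ())) ∷ inj₁ refl ∷ inj₂ (inj₂ (refl , λ ())) ∷ []

TargetSet⇒∈-terms : TargetSet n → ∃[ k ] n ∈ terms k
TargetSet⇒∈-terms (inj₁ refl)        = 0 , there (there (there (there (here refl))))
TargetSet⇒∈-terms (inj₂ (inj₁ refl)) = 0 , there (here refl)
TargetSet⇒∈-terms {n} (inj₂ (inj₂ (n%4≡1 , n≢9))) with %≡⇒mod {4} {n} n%4≡1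
... | 0 , refl = 0 , there (there (there (there (there (here refl)))))
... | 1 , refl = 0 , there (there (there (here refl)))
... | 2 , refl = ⊥-elim (n≢9 refl)
... | 3 , refl = 0 , there (there (here refl))
... | 4 , refl = 0 , here refl
... | suc (suc (suc (suc (suc i)))) , refl = suc i , here (lemma i)
  where
  lemma : ∀ i → 1 + (5 + i) * 4 ≡ 21 + 4 * i
  lemma = solve-∀

TargetSet⇒odd : TargetSet x → x ≡ 1 mod 2
TargetSet⇒odd (inj₁ refl)        = 1 , refl
TargetSet⇒odd (inj₂ (inj₁ refl)) = 7 , refl
TargetSet⇒odd {x} (inj₂ (inj₂ (x%4≡1 , _))) with %≡⇒mod {4} {x} x%4≡1
... | q , refl = q * 2 , cong (1 +_) (sym (*-assoc q 2 2))

terms-odd : ∀ k → All (_≡ 1 mod 2) (terms k)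
terms-odd k = All.map TargetSet⇒odd (All-TargetSet-terms k)

double-odd+odd : x ≡ 1 mod 2 → y ≡ 1 mod 2 → 2 * x + y ≡ 1 mod 2
double-odd+odd (t , refl) (u , refl) = 1 + 2 * t + u , lemma t u
  where
  lemma : ∀ t u → 2 * (1 + t * 2) + (1 + u * 2) ≡ 1 + (1 + 2 * t + u) * 2
  lemma = solve-∀

double-odd+1mod4 : x ≡ 1 mod 2 → y ≡ 1 mod 4 → 2 * x + y ≡ 3 mod 4
double-odd+1mod4 (t , refl) (u , refl) = t + u , lemma t u
  where
  lemma : ∀ t u → 2 * (1 + t * 2) + (1 + u * 4) ≡ 3 + (t + u) * 4
  lemma = solve-∀

reps-even≡0 : All (_≡ 1 mod 2) xs → n ≡ 0 mod 2 → reps xs n ≡ 0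
reps-even≡0 {xs} {n} odd n-even = trans (reps≡sum-rep xs n) (sum-map-≡0 (All.map inner odd))
  where
  inner : x ≡ 1 mod 2 → sum (map (rep n x) xs) ≡ 0
  inner x-odd = sum-map-≡0 (All.map (λ y-odd → miss (double-odd+odd x-odd y-odd)) odd)
    where
    miss : 2 * x + y ≡ 1 mod 2 → rep n x y ≡ 0
    miss 2x+y-odd = rep≡0-mod (≤ᵇ⇒≤ 2 2 _) (≤ᵇ⇒≤ 1 2 _) (λ ()) 2x+y-odd n-even

reps-last+2≥2 : ∀ m → 2 ≤ reps (terms (3 + m)) (23 + 4 * (2 + m))
reps-last+2≥2 m = begin
  2                                   ≡⟨ cong₂ _+_ (rep≡1 (λ ()) (lemma m)) (rep≡1 (λ ()) refl) ⟨
  rep t+2 5 (21 + 4 * m) + rep t+2 1 t  ≤⟨ +-mono-≤ (≤sum-map (rep t+2 5) (in-progression m (m<n+m m z<s)))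
                                                  (≤sum-map (rep t+2 1) (in-progression (2 + m) ≤-refl)) ⟩
  inner 5 + inner 1                     ≤⟨ +≤sum-map inner (in-initial (there (there (there (here refl)))))
                                             (in-initial (there (there (there (there (there (here refl))))))) (λ ()) ⟩
  sum (map inner (terms (3 + m)))       ≡⟨ reps≡sum-rep (terms (3 + m)) t+2 ⟨
  reps (terms (3 + m)) t+2              ∎
  where
  open ≤-Reasoning
  t t+2 : ℕ
  t+2 = 23 + 4 * (2 + m)
  t = 21 + 4 * (2 + m)
  inner : ℕ → ℕ
  inner x = sum (map (rep t+2 x) (terms (3 + m)))
  in-progression : ∀ i → i < 3 + m → 21 + 4 * i ∈ terms (3 + m)
  in-progression i i<k = ∈-++⁺ˡ (∈-applyDownFrom⁺ _ i<k)
  in-initial : x ∈ initial → x ∈ terms (3 + m)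
  in-initial = ∈-++⁺ʳ (progression (3 + m))
  lemma : ∀ m → 2 * 5 + (21 + 4 * m) ≡ 23 + 4 * (2 + m)
  lemma = solve-∀

sum-rep-terms : x ≡ 1 mod 2 → n ≡ 1 mod 4 → sum (map (rep n x) (terms k)) ≡ rep n x 15 + rep n x 3
sum-rep-terms {x} {n} {k} x-odd n≡1 = begin
  sum (map (rep n x) (progression k ++ initial))
    ≡⟨ sum-map-++ (rep n x) (progression k) initial ⟩
  sum (map (rep n x) (progression k)) + sum (map (rep n x) initial)
    ≡⟨ cong (_+ sum (map (rep n x) initial)) (sum-map-≡0 (applyDownFrom⁺₂ _ k λ i → miss (progression-mod4 i))) ⟩
  sum (map (rep n x) initial)
    ≡⟨ on-initial ⟩
  rep n x 15 + rep n x 3 ∎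
  where
  open ≡-Reasoning
  miss : y ≡ 1 mod 4 → rep n x y ≡ 0
  miss y≡1 = rep≡0-mod (≤ᵇ⇒≤ _ _ _) (≤ᵇ⇒≤ _ _ _) (λ ()) (double-odd+1mod4 x-odd y≡1) n≡1
  on-initial : sum (map (rep n x) initial) ≡ rep n x 15 + rep n x 3
  on-initial rewrite miss {17} (4 , refl) | miss {13} (3 , refl) | miss {5} (1 , refl) | miss {1} (0 , refl) =
    cong (rep n x 15 +_) (+-identityʳ (rep n x 3))

reps-terms-1mod4 : 2 * 17 + 15 < n → n ≡ 1 mod 4 →
  reps (terms k) n ≡ sum (map (λ x → rep n x 15) (progression k)) + sum (map (λ x → rep n x 3) (progression k))
reps-terms-1mod4 {n} {k} 49<n n≡1 = begin
  reps (terms k) n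
    ≡⟨ reps≡sum-rep (terms k) n ⟩
  sum (map (λ x → sum (map (rep n x) (terms k))) (terms k))
    ≡⟨ sum-map-cong (All.map (λ x-odd → sum-rep-terms {k = k} x-odd n≡1) (terms-odd k)) ⟩
  sum (map g (progression k ++ initial))
    ≡⟨ sum-map-++ g (progression k) initial ⟩
  sum (map g (progression k)) + sum (map g initial)
    ≡⟨ cong (sum (map g (progression k)) +_) (sum-map-≡0 on-initial) ⟩
  sum (map g (progression k)) + 0
    ≡⟨ +-identityʳ _ ⟩
  sum (map g (progression k))
    ≡⟨ sum-map-+ (λ x → rep n x 15) (λ x → rep n x 3) (progression k) ⟩
  sum (map (λ x → rep n x 15) (progression k)) + sum (map (λ x → rep n x 3) (progression k)) ∎
  where
  open ≡-Reasoning
  g : ℕ → ℕ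
  g x = rep n x 15 + rep n x 3
  small : ∀ x → T (2 * x + 15 ≤ᵇ 2 * 17 + 15) → g x ≡ 0
  small x ≤49 = cong₂ _+_ (rep≡0-< 2x+15<n) (rep≡0-< (≤-<-trans 2x+3≤2x+15 2x+15<n))
    where
    2x+15<n : 2 * x + 15 < n
    2x+15<n = ≤-<-trans (≤ᵇ⇒≤ _ _ ≤49) 49<n
    2x+3≤2x+15 : 2 * x + 3 ≤ 2 * x + 15
    2x+3≤2x+15 = +-monoʳ-≤ (2 * x) (≤ᵇ⇒≤ 3 15 _)
  on-initial : All (λ x → g x ≡ 0) initial
  on-initial = small 17 _ ∷ small 15 _ ∷ small 13 _ ∷ small 5 _ ∷ small 3 _ ∷ small 1 _ ∷ []

progression-injective : ∀ i j → 2 * (21 + 4 * i) + y ≡ 2 * (21 + 4 * j) + y → i ≡ j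
progression-injective {y} i j e =
  *-cancelˡ-≡ i j 4 (+-cancelˡ-≡ 21 _ _ (*-cancelˡ-≡ (21 + 4 * i) (21 + 4 * j) 2 (+-cancelʳ-≡ y _ _ e)))

sum-rep-progression≡1 : y < 21 → p < k → sum (map (λ x → rep (2 * (21 + 4 * p) + y) x y) (progression k)) ≡ 1
sum-rep-progression≡1 {y} {p} y<21 p<k =
  sum-map-applyDownFrom≡1 _ _ p<k (rep≡1 x≢y refl) λ i _ i≢p → rep≡0 (i≢p ∘ progression-injective i p)
  where
  x≢y : 21 + 4 * p ≢ y
  x≢y x≡y = <⇒≱ y<21 (subst (21 ≤_) x≡y (m≤m+n 21 (4 * p)))

sum-rep-progression≡0 : (∀ i → 2 * (21 + 4 * i) + y ≢ n) →
                        sum (map (λ x → rep n x y) (progression k)) ≡ 0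
sum-rep-progression≡0 {k = k} miss = sum-map-≡0 (applyDownFrom⁺₂ _ k λ i → rep≡0 (miss i))

progression-3≢15 : ∀ i j → 2 * (21 + 4 * i) + 3 ≢ 2 * (21 + 4 * j) + 15
progression-3≢15 i j e =
  case mod-unique (≤ᵇ⇒≤ 6 8 _) (≤ᵇ⇒≤ 2 8 _) (5 + i , lemma₃ i) (7 + j , trans e (lemma₁₅ j)) of λ ()
  where
  lemma₃ : ∀ i → 2 * (21 + 4 * i) + 3 ≡ 5 + (5 + i) * 8
  lemma₃ = solve-∀
  lemma₁₅ : ∀ j → 2 * (21 + 4 * j) + 15 ≡ 1 + (7 + j) * 8
  lemma₁₅ = solve-∀

single-rep-progression : ∃[ p ] p < k × (n ≡ 2 * (21 + 4 * p) + 15 ⊎ n ≡ 2 * (21 + 4 * p) + 3) →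
  sum (map (λ x → rep n x 15) (progression k)) + sum (map (λ x → rep n x 3) (progression k)) ≡ 1
single-rep-progression {k} (p , p<k , inj₁ refl) =
  cong₂ _+_ (sum-rep-progression≡1 (≤ᵇ⇒≤ 16 21 _) p<k)
            (sum-rep-progression≡0 {k = k} λ i → progression-3≢15 i p)
single-rep-progression {k} (p , p<k , inj₂ refl) =
  cong₂ _+_ (sum-rep-progression≡0 {k = k} λ i e → progression-3≢15 p i (sym e))
            (sum-rep-progression≡1 (≤ᵇ⇒≤ 4 21 _) p<k)

last+4-representation : ∀ m → ∃[ p ] p < 8 + m ×
  (25 + 4 * (7 + m) ≡ 2 * (21 + 4 * p) + 15 ⊎ 25 + 4 * (7 + m) ≡ 2 * (21 + 4 * p) + 3)
last+4-representation m with mod2-cases m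
... | inj₁ (q , refl) = 1 + q , s≤s (s≤s (≤-trans (m≤m*n q 2) (m≤n+m _ 6))) , inj₂ (lemma q)
  where
  lemma : ∀ q → 25 + 4 * (7 + (0 + q * 2)) ≡ 2 * (21 + 4 * (1 + q)) + 3
  lemma = solve-∀
... | inj₂ (q , refl) = q , s≤s (≤-trans (m≤m*n q 2) (m≤n+m _ 8)) , inj₁ (lemma q)
  where
  lemma : ∀ q → 25 + 4 * (7 + (1 + q * 2)) ≡ 2 * (21 + 4 * q) + 15
  lemma = solve-∀

reps-last+4≡1 : ∀ m → reps (terms (8 + m)) (25 + 4 * (7 + m)) ≡ 1
reps-last+4≡1 m =
  trans (reps-terms-1mod4 {k = 8 + m} 49<n (13 + m , lemma m)) (single-rep-progression (last+4-representation m))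
  where
  49<n : 2 * 17 + 15 < 25 + 4 * (7 + m)
  49<n = ≤-trans (≤ᵇ⇒≤ 50 53 _) (+-monoʳ-≤ 25 (*-monoʳ-≤ 4 (m≤m+n 7 m)))
  lemma : ∀ m → 25 + 4 * (7 + m) ≡ 1 + (13 + m) * 4
  lemma = solve-∀

next-terms-≥8 : ∀ m → next (terms (8 + m)) ≡ just (25 + 4 * (7 + m))
next-terms-≥8 m =
  search-first {terms (8 + m)} (2 * t) (suc t) 3 (s≤s (s≤s (s≤s (s≤s z≤n)))) miss (reps-last+4≡1 m)
  where
  t : ℕ
  t = 21 + 4 * (7 + m)
  no-reps : reps (terms (8 + m)) c ≡ 0 → reps (terms (8 + m)) c ≢ 1
  no-reps reps≡0 reps≡1 = 0≢1+n (trans (sym reps≡0) reps≡1)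
  miss : ∀ i → i < 3 → reps (terms (8 + m)) (i + suc t) ≢ 1
  miss 0 _ = no-reps (reps-even≡0 (terms-odd (8 + m)) (11 + 2 * (7 + m) , lemma₀ m))
    where
    lemma₀ : ∀ m → 22 + 4 * (7 + m) ≡ 0 + (11 + 2 * (7 + m)) * 2
    lemma₀ = solve-∀
  miss 1 _ = >⇒≢ (reps-last+2≥2 (5 + m))
  miss 2 _ = no-reps (reps-even≡0 (terms-odd (8 + m)) (12 + 2 * (7 + m) , lemma₂ m))
    where
    lemma₂ : ∀ m → 24 + 4 * (7 + m) ≡ 0 + (12 + 2 * (7 + m)) * 2
    lemma₂ = solve-∀
  miss (suc (suc (suc _))) (s≤s (s≤s (s≤s ())))

next-terms : ∀ k → next (terms k) ≡ just (21 + 4 * k)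
next-terms 0 = refl
next-terms 1 = refl
next-terms 2 = refl
next-terms 3 = refl
next-terms 4 = refl
next-terms 5 = refl
next-terms 6 = refl
next-terms 7 = refl
next-terms (suc (suc (suc (suc (suc (suc (suc (suc m)))))))) = trans (next-terms-≥8 m) (cong just (lemma m))
  where
  lemma : ∀ m → 25 + 4 * (7 + m) ≡ 21 + 4 * (8 + m)
  lemma = solve-∀

Z-1-3≡terms : ∀ k → Z 1 3 (4 + k) ≡ terms k
Z-1-3≡terms zero    = refl
Z-1-3≡terms (suc k) = begin
  Z 1 3 (5 + k)                   ≡⟨ Z-step {1} {3} {4 + k} (trans (cong next (Z-1-3≡terms k)) (next-terms k)) ⟩
  21 + 4 * k ∷ Z 1 3 (4 + k)      ≡⟨ cong (21 + 4 * k ∷_) (Z-1-3≡terms k) ⟩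
  terms (suc k)                   ∎
  where open ≡-Reasoning

theorem1p5 : ∀ (n : ℕ) → IsTerm 1 3 n ⇔ TargetSet n
theorem1p5 n = mk⇔ term⇒target target⇒term
  where
  term⇒target : IsTerm 1 3 n → TargetSet n
  term⇒target (k , n∈Z) =
    All.lookup (All-TargetSet-terms k) (subst (n ∈_) (Z-1-3≡terms k) (∈-Z-+ {a = 1} {3} {k} 4 n∈Z))
  target⇒term : TargetSet n → IsTerm 1 3 n
  target⇒term target with TargetSet⇒∈-terms target
  ... | k , n∈terms = 4 + k , subst (n ∈_) (sym (Z-1-3≡terms k)) n∈terms
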